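{- Let $\mathbb{K}$ be a field of characteristic zero, $\mathcal{A}$, $\rho$ and $X$ as in the context. Define $(\rho X)^{[1]}=\rho X$ and $(\rho X)^{[n+1]}=\rho\big((\rho X)^{[n]}X\big)$ for $n\ge1$. Then the elements $(\rho X)^{[n]}$, $n\ge 1$, freely generate a subalgebra of $\mathcal{A}$ (for the componentwise product), and they also freely generate a subalgebra of $\mathcal{A}$ equipped with the product $a\ast_\rho b:=\rho(a)b+a\rho(b)+ab$.
   Context: $T(X)$ is the free associative unital $\mathbb{K}$-algebra on countably many noncommuting variables $x_1,x_2,\dots$; $\mathcal{A}$ is the algebra of sequences $(y_1,y_2,\dots)$ of elements of $T(X)$ with componentwise addition and product; $\rho:\mathcal{A}\to\mathcal{A}$ is $\rho(y_1,y_2,\dots)=(0,y_1,y_1+y_2,y_1+y_2+y_3,\dots)$; and $X=(x_1,x_2,x_3,\dots)\in\mathcal{A}$. "Freely generate" means the subalgebra they generate is a free associative algebra on these elements. -}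

module Defs where

open import Level using (Level; _⊔_) renaming (suc to lsuc)
open import Algebra.Bundles using (CommutativeRing)
open import Data.Nat as ℕ using (ℕ; zero; suc)
open import Data.List using (List; []; _∷_; _++_; map; concatMap; foldr)
open import Data.List.Properties using (≡-dec)
open import Data.Product using (_×_; _,_; Σ; proj₁; proj₂)
open import Relation.Nullary using (¬_; yes; no)
open import Relation.Binary.PropositionalEquality using (_≡_)

module _ {c ℓ : Level} (R : CommutativeRing c ℓ) where
  open CommutativeRing R

  natCast : ℕ → Carrier
  natCast zero    = 0#
  natCast (suc n) = 1# + natCast n

  record IsField : Set (c ⊔ ℓ) where
    field
      nontrivial : ¬ (1# ≈ 0#)
      inverse    : ∀ x → ¬ (x ≈ 0#) → Σ Carrier (λ y → x * y ≈ 1#)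

  CharZero : Set ℓ
  CharZero = ∀ n → ¬ (natCast (suc n) ≈ 0#)

-- The free associative unital algebra T(X) on x₀, x₁, x₂, … (x_i here is
-- x_{i+1} of the paper), the sequence algebra 𝒜, ρ, X and (ρX)^[n].

module FreeSeq {c ℓ : Level} (R : CommutativeRing c ℓ) where
  open CommutativeRing R renaming (Carrier to K)

  Word : Set
  Word = List ℕ

  -- a noncommutative polynomial: a finite formal K-linear combination of words
  Poly : Set c
  Poly = List (K × Word)

  coeff : Poly → Word → K
  coeff []             w = 0#
  coeff ((a , v) ∷ p)  w with ≡-dec ℕ._≟_ v w
  ... | yes _ = a + coeff p w
  ... | no  _ = coeff p w

  _≈P_ : Poly → Poly → Set ℓ
  p ≈P q = ∀ w → coeff p w ≈ coeff q w

  0P : Poly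
  0P = []

  1P : Poly
  1P = (1# , []) ∷ []

  var : ℕ → Poly
  var i = (1# , i ∷ []) ∷ []

  _+P_ : Poly → Poly → Poly
  p +P q = p ++ q

  _·P_ : K → Poly → Poly
  a ·P p = map (λ t → a * proj₁ t , proj₂ t) p

  _*P_ : Poly → Poly → Poly
  p *P q = concatMap (λ s → map (λ t → proj₁ s * proj₁ t , proj₂ s ++ proj₂ t) q) p

  -- the algebra 𝒜 of sequences (index 0 here is index 1 of the paper)
  𝒜 : Set c
  𝒜 = ℕ → Poly

  _≈A_ : 𝒜 → 𝒜 → Set ℓ
  a ≈A b = ∀ n → a n ≈P b n

  0A : 𝒜
  0A _ = 0P

  1A : 𝒜
  1A _ = 1P

  _+A_ : 𝒜 → 𝒜 → 𝒜
  (a +A b) n = a n +P b n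

  _·A_ : K → 𝒜 → 𝒜
  (k ·A a) n = k ·P a n

  _*A_ : 𝒜 → 𝒜 → 𝒜
  (a *A b) n = a n *P b n

  ρ : 𝒜 → 𝒜
  ρ y zero    = 0P
  ρ y (suc n) = ρ y n +P y n

  X : 𝒜
  X n = var n

  _∗ρ_ : 𝒜 → 𝒜 → 𝒜
  a ∗ρ b = ((ρ a *A b) +A (a *A ρ b)) +A (a *A b)

  -- gen n = (ρX)^[n+1]:  (ρX)^[1] = ρX,  (ρX)^[n+1] = ρ((ρX)^[n] X)
  gen : ℕ → 𝒜
  gen zero    = ρ X
  gen (suc n) = ρ (gen n *A X)

  -- Evaluation of the free algebra on generators y₀, y₁, … (again
  -- represented by Poly) at y_i ↦ gen i.

  evalWord : Word → 𝒜
  evalWord []      = 1A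
  evalWord (i ∷ w) = gen i *A evalWord w

  eval : Poly → 𝒜
  eval []            = 0A
  eval ((a , w) ∷ p) = (a ·A evalWord w) +A eval p

  -- non-unital, product ∗_ρ (right-nested; only used on nonempty words)
  evalWordρ : Word → 𝒜
  evalWordρ []          = 0A
  evalWordρ (i ∷ [])    = gen i
  evalWordρ (i ∷ j ∷ w) = gen i ∗ρ evalWordρ (j ∷ w)

  evalρ : Poly → 𝒜
  evalρ []            = 0A
  evalρ ((a , w) ∷ p) = (a ·A evalWordρ w) +A evalρ p

  FreelyGenerate : Set (c ⊔ ℓ)
  FreelyGenerate = ∀ p → eval p ≈A 0A → p ≈P 0P

  -- the gen i freely generate a (non-unital) subalgebra for ∗_ρ:
  -- the map from the free non-unital algebra (no constant term) is injective
  FreelyGenerateρ : Set (c ⊔ ℓ)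
  FreelyGenerateρ = ∀ p → coeff p [] ≈ 0# → evalρ p ≈A 0A → p ≈P 0P

-- Write gₖ for (ρX)^[k+1]. Its m-th component is the sum of the words x_{i₀}⋯x_{iₖ} with
-- i₀ < ⋯ < iₖ < m, so the m-th component of g_{k₁}⋯g_{kᵣ} is a sum of concatenations of r
-- strictly ascending blocks of lengths k₁+1, …, kᵣ+1. Test it against the staircase word
-- 0 1 ⋯ k₁ 0 1 ⋯ k₂ ⋯ 0 1 ⋯ kᵣ: a product g_{l₁}⋯g_{lₛ} reaches it only by cutting each step of
-- the staircase into ascending blocks, which forces l = k or Σ lⱼ < Σ kᵢ, and for l = k the
-- coefficient is 1. The coefficients of these staircase words thus form a unitriangular system
-- with respect to the weight Σ kᵢ, so only the zero polynomial evaluates to zero.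
-- For ∗ρ, ρ is a homomorphism from (𝒜, ∗ρ) to (𝒜, ·), so the same argument applies to the
-- ρ(gₖ). The m-th component of ρ(gₖ) has coefficient m − 1 − iₖ on an ascending word ending in
-- iₖ; on the diagonal these are positive integers, invertible in a field of characteristic zero.

module Submission where

open import Defs
open import Level using (Level)
open import Algebra.Bundles using (CommutativeRing)
open import Data.Empty using (⊥-elim)
open import Data.List using (List; []; _∷_; _++_; _∷ʳ_; length; map)
open import Data.List.Properties
  using (≡-dec; ∷-injective; ∷ʳ-injective; ∷ʳ-injectiveʳ; ++-identityʳ; ++-assoc; length-++;
         length-++-≤ˡ)
open import Data.List.Relation.Unary.All as All using (All; []; _∷_)
open import Data.List.Relation.Unary.All.Properties using (∷ʳ⁺)
open import Data.List.Relation.Unary.Linked as Linked using (Linked; []; [-]; _∷_)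
open import Data.Nat as ℕ using (ℕ; zero; suc; _≤_; _<_; z≤n; s≤s; compare; less; equal; greater)
open import Data.Nat.ListAction using (sum)
import Data.Nat.Properties as ℕₚ
open import Data.Product using (_×_; _,_; ∃; proj₁; proj₂)
open import Data.Sum using (_⊎_; inj₁; inj₂)
open import Function using (_∘_)
open import Relation.Nullary using (¬_; yes; no)
open import Relation.Binary.PropositionalEquality as ≡ using (_≡_; _≢_; refl)

module Words where
  open import Data.Nat using (_+_)
  open ℕₚ

  prefix-unique : ∀ (u₁ u₂ a b : List ℕ) → u₁ ++ u₂ ≡ a ++ b → length u₁ ≡ length a → u₁ ≡ a
  prefix-unique []       _  []      _ _  _   = refl
  prefix-unique (x ∷ u₁) u₂ (y ∷ a) b eq len with refl , eq′ ← ∷-injective eq =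
    ≡.cong (x ∷_) (prefix-unique u₁ u₂ a b eq′ (suc-injective len))

  run : ℕ → ℕ → List ℕ
  run s zero    = s ∷ []
  run s (suc k) = s ∷ run (suc s) k

  length-run : ∀ s k → length (run s k) ≡ suc k
  length-run s zero    = refl
  length-run s (suc k) = ≡.cong suc (length-run (suc s) k)

  run-∷ʳ : ∀ s k → run s (suc k) ≡ run s k ∷ʳ (suc k + s)
  run-∷ʳ s zero    = refl
  run-∷ʳ s (suc k) = ≡.cong (s ∷_)
    (≡.trans (run-∷ʳ (suc s) k) (≡.cong (run (suc s) k ∷ʳ_) (+-suc (suc k) s)))

  run-split : ∀ s k d → run s (suc (k + d)) ≡ run s k ++ run (suc k + s) d
  run-split s zero    d = refl
  run-split s (suc k) d = ≡.cong (s ∷_)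
    (≡.trans (run-split (suc s) k d) (≡.cong (λ t → run (suc s) k ++ run t d) (+-suc (suc k) s)))

  run-below : ∀ {m} s k → All (_< m) (run s k) → k + s < m
  run-below s zero    (s<m ∷ [])  = s<m
  run-below {m} s (suc k) (_ ∷ run<m) = ≡.subst (_< m) (+-suc k s) (run-below (suc s) k run<m)

  Ascending : ℕ → List ℕ → Set
  Ascending k u = length u ≡ suc k × Linked _<_ u

  Linked-∷ʳ : ∀ {m u} → All (_< m) u → Linked _<_ u → Linked _<_ (u ∷ʳ m)
  Linked-∷ʳ []             []          = [-]
  Linked-∷ʳ (x<m ∷ [])     [-]         = x<m ∷ [-]
  Linked-∷ʳ (_ ∷ rest<m)   (x<y ∷ lnk) = x<y ∷ Linked-∷ʳ rest<m lnk

  ascending-∷ʳ : ∀ {k m u} → Ascending k u × All (_< m) u →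
                 Ascending (suc k) (u ∷ʳ m) × All (_< suc m) (u ∷ʳ m)
  ascending-∷ʳ {k} {m} {u} ((len , lnk) , u<m) =
    (≡.trans (length-++ u) (≡.trans (≡.cong (_+ 1) len) (+-comm (suc k) 1)) , Linked-∷ʳ u<m lnk) ,
    ∷ʳ⁺ (All.map m<n⇒m<1+n u<m) (n<1+n m)

  below-suc : ∀ {k m u} → Ascending k u × All (_< m) u → Ascending k u × All (_< suc m) u
  below-suc (asc , u<m) = asc , All.map m<n⇒m<1+n u<m

  ¬Linked-past-run : ∀ {x r u₁ u₂} s k → u₁ ++ u₂ ≡ run s k ++ x ∷ r → x ≤ s → suc k < length u₁ →
                     ¬ Linked _<_ u₁
  ¬Linked-past-run s zero eq x≤s lt (y<z ∷ _)
    with refl , eq′ ← ∷-injective eq with refl , _ ← ∷-injective eq′ = <⇒≱ y<z x≤s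
  ¬Linked-past-run s zero eq x≤s (s≤s ()) [-]
  ¬Linked-past-run {u₁ = y ∷ u₁} s (suc k) eq x≤s (s≤s lt) lnk with refl , eq′ ← ∷-injective eq =
    ¬Linked-past-run (suc s) k eq′ (m≤n⇒m≤1+n x≤s) lt (Linked.tail lnk)

  staircase : ℕ → List ℕ → List ℕ
  staircase s []      = []
  staircase s (k ∷ w) = run s k ++ staircase 0 w

  staircase-head : ∀ s k w → ∃ λ r → staircase s (k ∷ w) ≡ s ∷ r
  staircase-head s zero    w = _ , refl
  staircase-head s (suc k) w = _ , refl

  staircase-split : ∀ s k d w → staircase s (suc (k + d) ∷ w) ≡ run s k ++ staircase (suc k + s) (d ∷ w)
  staircase-split s k d w =
    ≡.trans (≡.cong (_++ staircase 0 w) (run-split s k d)) (++-assoc (run s k) _ _)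

  ¬Linked-staircase-prefix : ∀ {u₁ u₂} s k w → u₁ ++ u₂ ≡ staircase s (k ∷ w) → suc k < length u₁ →
                             ¬ Linked _<_ u₁
  ¬Linked-staircase-prefix {u₁} {u₂} s k [] eq lt _ = <⇒≱ lt (begin
    length u₁               ≤⟨ length-++-≤ˡ u₁ ⟩
    length (u₁ ++ u₂)       ≡⟨ ≡.cong length eq ⟩
    length (run s k ++ [])  ≡⟨ ≡.cong length (++-identityʳ (run s k)) ⟩
    length (run s k)        ≡⟨ length-run s k ⟩
    suc k                   ∎)
    where open ≤-Reasoning
  ¬Linked-staircase-prefix s k (j ∷ w) eq lt with r , eq′ ← staircase-head 0 j w =
    ¬Linked-past-run s k (≡.trans eq (≡.cong (run s k ++_) eq′)) z≤n lt

  split-weight-< : ∀ k d {x W} → x ≤ d + W → k + x < suc (k + d) + W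
  split-weight-< k d {W = W} x≤ = s≤s (≤-trans (+-monoʳ-≤ k x≤) (≤-reflexive (≡.sym (+-assoc k d W))))

  All-≤-sum : ∀ w → All (_≤ sum w) w
  All-≤-sum []      = []
  All-≤-sum (k ∷ w) = m≤m+n k (sum w) ∷ All.map (λ j≤ → ≤-trans j≤ (m≤n+m (sum w) k)) (All-≤-sum w)

module Coefficients {c ℓ : Level} (R : CommutativeRing c ℓ) where
  open CommutativeRing R renaming (Carrier to K; refl to ≈-refl) hiding (zero)
  open FreeSeq R
  open import Algebra.Definitions _≈_ using (RightInvertible)
  open import Algebra.Properties.CommutativeSemigroup +-commutativeSemigroup using (interchange; x∙yz≈y∙xz)
  open import Algebra.Properties.CommutativeSemigroup *-commutativeSemigroup
    using () renaming (interchange to *-interchange)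
  open import Relation.Binary.Reasoning.Setoid setoid

  Fn : Set c
  Fn = Word → K

  infix 4 _≐_
  _≐_ : Fn → Fn → Set ℓ
  f ≐ g = ∀ u → f u ≈ g u

  infixl 6 _⊕_
  _⊕_ : Fn → Fn → Fn
  (f ⊕ g) u = f u + g u

  single : K → Word → Fn
  single a t = coeff ((a , t) ∷ [])

  *-≈0 : ∀ {a b} → a ≈ 0# ⊎ b ≈ 0# → a * b ≈ 0#
  *-≈0 {a} {b} (inj₁ a≈0) = trans (*-congʳ a≈0) (zeroˡ b)
  *-≈0 {a} {b} (inj₂ b≈0) = trans (*-congˡ b≈0) (zeroʳ a)

  coeff-∷-≢ : ∀ a t p u → t ≢ u → coeff ((a , t) ∷ p) u ≈ coeff p u
  coeff-∷-≢ a t p u t≢u with ≡-dec ℕ._≟_ t u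
  ... | yes t≡u = ⊥-elim (t≢u t≡u)
  ... | no _    = ≈-refl

  coeff-∷ : ∀ a t p → coeff ((a , t) ∷ p) ≐ single a t ⊕ coeff p
  coeff-∷ a t p u with ≡-dec ℕ._≟_ t u
  ... | yes _ = +-congʳ (sym (+-identityʳ a))
  ... | no _  = sym (+-identityˡ _)

  single-≡ : ∀ a t → single a t t ≈ a
  single-≡ a t with ≡-dec ℕ._≟_ t t
  ... | yes _  = +-identityʳ a
  ... | no t≢t = ⊥-elim (t≢t refl)

  single-≢ : ∀ a t u → t ≢ u → single a t u ≈ 0#
  single-≢ a t u = coeff-∷-≢ a t [] u

  single-support : ∀ a t u → t ≡ u ⊎ single a t u ≈ 0#
  single-support a t u with ≡-dec ℕ._≟_ t u
  ... | yes t≡u = inj₁ t≡u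
  ... | no _    = inj₂ ≈-refl

  coeff-++ : ∀ p q → coeff (p ++ q) ≐ coeff p ⊕ coeff q
  coeff-++ []            q u = sym (+-identityˡ _)
  coeff-++ ((a , t) ∷ p) q u with ≡-dec ℕ._≟_ t u
  ... | yes _ = trans (+-congˡ (coeff-++ p q u)) (sym (+-assoc _ _ _))
  ... | no _  = coeff-++ p q u

  coeff-· : ∀ a p u → coeff (a ·P p) u ≈ a * coeff p u
  coeff-· a []            u = sym (zeroʳ a)
  coeff-· a ((b , t) ∷ p) u with ≡-dec ℕ._≟_ t u
  ... | yes _ = trans (+-congˡ (coeff-· a p u)) (sym (distribˡ a b _))
  ... | no _  = coeff-· a p u

  -- (f ⋆ g) μ is the sum of f u * g v over all splittings μ = u ++ v.
  infixl 7 _⋆_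
  _⋆_ : Fn → Fn → Fn
  (f ⋆ g) []      = f [] * g []
  (f ⋆ g) (x ∷ μ) = f [] * g (x ∷ μ) + ((λ u → f (x ∷ u)) ⋆ g) μ

  ⋆-cong : ∀ {f f′ g g′} → f ≐ f′ → g ≐ g′ → f ⋆ g ≐ f′ ⋆ g′
  ⋆-cong f≐f′ g≐g′ []      = *-cong (f≐f′ []) (g≐g′ [])
  ⋆-cong f≐f′ g≐g′ (x ∷ μ) =
    +-cong (*-cong (f≐f′ []) (g≐g′ (x ∷ μ))) (⋆-cong (λ u → f≐f′ (x ∷ u)) g≐g′ μ)

  ⋆-vanishes : ∀ f g μ → (∀ u v → u ++ v ≡ μ → f u ≈ 0# ⊎ g v ≈ 0#) → (f ⋆ g) μ ≈ 0#
  ⋆-vanishes f g []      split = *-≈0 (split [] [] refl)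
  ⋆-vanishes f g (x ∷ μ) split = trans
    (+-cong (*-≈0 (split [] (x ∷ μ) refl))
            (⋆-vanishes (λ u → f (x ∷ u)) g μ (λ u v eq → split (x ∷ u) v (≡.cong (x ∷_) eq))))
    (+-identityˡ 0#)

  ⋆-split : ∀ f g a b → (∀ u v → u ++ v ≡ a ++ b → u ≢ a → f u ≈ 0# ⊎ g v ≈ 0#) →
            (f ⋆ g) (a ++ b) ≈ f a * g b
  ⋆-split f g []      []      split = ≈-refl
  ⋆-split f g []      (x ∷ b) split = trans
    (+-congˡ (⋆-vanishes (λ u → f (x ∷ u)) g b
      (λ u v eq → split (x ∷ u) v (≡.cong (x ∷_) eq) (λ ()))))
    (+-identityʳ _)
  ⋆-split f g (x ∷ a) b split = trans
    (+-congʳ (*-≈0 (split [] (x ∷ a ++ b) refl (λ ()))))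
    (trans (+-identityˡ _) (⋆-split (λ u → f (x ∷ u)) g a b
      (λ u v eq u≢a → split (x ∷ u) v (≡.cong (x ∷_) eq) (λ eq′ → u≢a (proj₂ (∷-injective eq′))))))

  ⋆-distribʳ : ∀ f f′ g → (f ⊕ f′) ⋆ g ≐ f ⋆ g ⊕ f′ ⋆ g
  ⋆-distribʳ f f′ g []      = distribʳ _ _ _
  ⋆-distribʳ f f′ g (x ∷ μ) =
    trans (+-cong (distribʳ _ _ _) (⋆-distribʳ _ _ g μ)) (interchange _ _ _ _)

  ⋆-distribˡ : ∀ f g g′ → f ⋆ (g ⊕ g′) ≐ f ⋆ g ⊕ f ⋆ g′
  ⋆-distribˡ f g g′ []      = distribˡ _ _ _
  ⋆-distribˡ f g g′ (x ∷ μ) =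
    trans (+-cong (distribˡ _ _ _) (⋆-distribˡ _ g g′ μ)) (interchange _ _ _ _)

  ⋆-identityʳ : ∀ f → f ⋆ coeff 1P ≐ f
  ⋆-identityʳ f []      = trans (*-congˡ (+-identityʳ 1#)) (*-identityʳ (f []))
  ⋆-identityʳ f (x ∷ μ) =
    trans (+-congʳ (zeroʳ (f []))) (trans (+-identityˡ _) (⋆-identityʳ (λ u → f (x ∷ u)) μ))

  single-⋆-single : ∀ a t b t′ → single a t ⋆ single b t′ ≐ single (a * b) (t ++ t′)
  single-⋆-single a t b t′ μ with ≡-dec ℕ._≟_ (t ++ t′) μ
  ... | yes refl = begin
    (single a t ⋆ single b t′) (t ++ t′)
      ≈⟨ ⋆-split _ _ t t′ (λ u v _ u≢t → inj₁ (single-≢ a t u (λ t≡u → u≢t (≡.sym t≡u)))) ⟩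
    single a t t * single b t′ t′
      ≈⟨ *-cong (single-≡ a t) (single-≡ b t′) ⟩
    a * b
      ≈⟨ +-identityʳ (a * b) ⟨
    a * b + 0# ∎
  ... | no tt′≢μ = ⋆-vanishes _ _ μ split
    where
    split : ∀ u v → u ++ v ≡ μ → single a t u ≈ 0# ⊎ single b t′ v ≈ 0#
    split u v uv≡μ with single-support a t u | single-support b t′ v
    ... | inj₁ refl | inj₁ refl = ⊥-elim (tt′≢μ uv≡μ)
    ... | inj₂ a≈0  | _         = inj₁ a≈0
    ... | _         | inj₂ b≈0  = inj₂ b≈0

  coeff-term-*P : ∀ a t q → coeff (map (λ s → a * proj₁ s , t ++ proj₂ s) q) ≐ single a t ⋆ coeff q
  coeff-term-*P a t []             μ = sym (⋆-vanishes _ _ μ (λ _ _ _ → inj₂ ≈-refl))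
  coeff-term-*P a t ((b , t′) ∷ q) μ = begin
    coeff ((a * b , t ++ t′) ∷ tq) μ
      ≈⟨ coeff-∷ (a * b) (t ++ t′) tq μ ⟩
    single (a * b) (t ++ t′) μ + coeff tq μ
      ≈⟨ +-cong (sym (single-⋆-single a t b t′ μ)) (coeff-term-*P a t q μ) ⟩
    (single a t ⋆ single b t′) μ + (single a t ⋆ coeff q) μ
      ≈⟨ ⋆-distribˡ (single a t) (single b t′) (coeff q) μ ⟨
    (single a t ⋆ (single b t′ ⊕ coeff q)) μ
      ≈⟨ ⋆-cong (λ _ → ≈-refl) (λ u → sym (coeff-∷ b t′ q u)) μ ⟩
    (single a t ⋆ coeff ((b , t′) ∷ q)) μ ∎
    where tq = map (λ s → a * proj₁ s , t ++ proj₂ s) q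

  coeff-*P : ∀ p q → coeff (p *P q) ≐ coeff p ⋆ coeff q
  coeff-*P []            q μ = sym (⋆-vanishes _ _ μ (λ _ _ _ → inj₁ ≈-refl))
  coeff-*P ((a , t) ∷ p) q μ = begin
    coeff (tq ++ p *P q) μ
      ≈⟨ coeff-++ tq (p *P q) μ ⟩
    coeff tq μ + coeff (p *P q) μ
      ≈⟨ +-cong (coeff-term-*P a t q μ) (coeff-*P p q μ) ⟩
    (single a t ⋆ coeff q) μ + (coeff p ⋆ coeff q) μ
      ≈⟨ ⋆-distribʳ (single a t) (coeff p) (coeff q) μ ⟨
    ((single a t ⊕ coeff p) ⋆ coeff q) μ
      ≈⟨ ⋆-cong (λ u → sym (coeff-∷ a t p u)) (λ _ → ≈-refl) μ ⟩
    (coeff ((a , t) ∷ p) ⋆ coeff q) μ ∎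
    where tq = map (λ s → a * proj₁ s , t ++ proj₂ s) q

  ⋆-var-∷ʳ : ∀ f x u → (f ⋆ coeff (var x)) (u ∷ʳ x) ≈ f u
  ⋆-var-∷ʳ f x u = trans (⋆-split f (coeff (var x)) u (x ∷ []) split)
    (trans (*-congˡ (single-≡ 1# (x ∷ []))) (*-identityʳ (f u)))
    where
    split : ∀ u₁ v → u₁ ++ v ≡ u ∷ʳ x → u₁ ≢ u → f u₁ ≈ 0# ⊎ coeff (var x) v ≈ 0#
    split u₁ v eq u₁≢u with single-support 1# (x ∷ []) v
    ... | inj₁ refl = ⊥-elim (u₁≢u (proj₁ (∷ʳ-injective u₁ u eq)))
    ... | inj₂ v≉x  = inj₂ v≉x

  ⋆-var-vanishes : ∀ f x u → (∀ u₁ → u ≡ u₁ ∷ʳ x → f u₁ ≈ 0#) → (f ⋆ coeff (var x)) u ≈ 0#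
  ⋆-var-vanishes f x u f≈0 = ⋆-vanishes _ _ u split
    where
    split : ∀ u₁ v → u₁ ++ v ≡ u → f u₁ ≈ 0# ⊎ coeff (var x) v ≈ 0#
    split u₁ v eq with single-support 1# (x ∷ []) v
    ... | inj₁ refl = inj₁ (f≈0 u₁ (≡.sym eq))
    ... | inj₂ v≉x  = inj₂ v≉x

  ⋆-product : (ℕ → Fn) → Word → Fn
  ⋆-product H []      = coeff 1P
  ⋆-product H (k ∷ v) = H k ⋆ ⋆-product H v

  ⟨_∣_⟩ : Fn → Poly → K
  ⟨ F ∣ [] ⟩          = 0#
  ⟨ F ∣ (a , v) ∷ p ⟩ = a * F v + ⟨ F ∣ p ⟩

  delete : Word → Poly → Poly
  delete v [] = []
  delete v ((a , t) ∷ p) with ≡-dec ℕ._≟_ t v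
  ... | yes _ = delete v p
  ... | no _  = (a , t) ∷ delete v p

  delete-∷ : ∀ a v p → delete v ((a , v) ∷ p) ≡ delete v p
  delete-∷ a v p with ≡-dec ℕ._≟_ v v
  ... | yes _  = refl
  ... | no v≢v = ⊥-elim (v≢v refl)

  length-delete : ∀ v p → length (delete v p) ≤ length p
  length-delete v [] = z≤n
  length-delete v ((a , t) ∷ p) with ≡-dec ℕ._≟_ t v
  ... | yes _ = ℕₚ.m≤n⇒m≤1+n (length-delete v p)
  ... | no _  = s≤s (length-delete v p)

  coeff-delete-≡ : ∀ v p → coeff (delete v p) v ≈ 0#
  coeff-delete-≡ v [] = ≈-refl
  coeff-delete-≡ v ((a , t) ∷ p) with ≡-dec ℕ._≟_ t v
  ... | yes _  = coeff-delete-≡ v p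
  ... | no t≢v = trans (coeff-∷-≢ a t (delete v p) v t≢v) (coeff-delete-≡ v p)

  coeff-delete-≢ : ∀ v p u → v ≢ u → coeff (delete v p) u ≈ coeff p u
  coeff-delete-≢ v [] u v≢u = ≈-refl
  coeff-delete-≢ v ((a , t) ∷ p) u v≢u with ≡-dec ℕ._≟_ t v
  ... | yes refl = trans (coeff-delete-≢ v p u v≢u) (sym (coeff-∷-≢ a t p u v≢u))
  ... | no _     = trans (coeff-∷ a t (delete v p) u)
                     (trans (+-congˡ (coeff-delete-≢ v p u v≢u)) (sym (coeff-∷ a t p u)))

  ⟨⟩-delete : ∀ F v p → ⟨ F ∣ p ⟩ ≈ coeff p v * F v + ⟨ F ∣ delete v p ⟩
  ⟨⟩-delete F v [] = sym (trans (+-identityʳ _) (zeroˡ (F v)))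
  ⟨⟩-delete F v ((a , t) ∷ p) with ≡-dec ℕ._≟_ t v
  ... | yes refl = begin
    a * F t + ⟨ F ∣ p ⟩                                ≈⟨ +-congˡ (⟨⟩-delete F t p) ⟩
    a * F t + (coeff p t * F t + ⟨ F ∣ delete t p ⟩)    ≈⟨ +-assoc _ _ _ ⟨
    (a * F t + coeff p t * F t) + ⟨ F ∣ delete t p ⟩    ≈⟨ +-congʳ (distribʳ (F t) a (coeff p t)) ⟨
    (a + coeff p t) * F t + ⟨ F ∣ delete t p ⟩          ∎
  ... | no t≢v = trans (+-congˡ (⟨⟩-delete F v p)) (x∙yz≈y∙xz _ _ _)

  ⟨⟩-vanishes : ∀ F p → (∀ v → coeff p v ≈ 0# ⊎ F v ≈ 0#) → ⟨ F ∣ p ⟩ ≈ 0#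
  ⟨⟩-vanishes F p = go (length p) p ℕₚ.≤-refl
    where
    go : ∀ n p → length p ≤ n → (∀ v → coeff p v ≈ 0# ⊎ F v ≈ 0#) → ⟨ F ∣ p ⟩ ≈ 0#
    go _       []            _         _   = ≈-refl
    go (suc n) ((a , v) ∷ p) (s≤s len) hyp = begin
      ⟨ F ∣ (a , v) ∷ p ⟩
        ≈⟨ ⟨⟩-delete F v ((a , v) ∷ p) ⟩
      coeff ((a , v) ∷ p) v * F v + ⟨ F ∣ delete v ((a , v) ∷ p) ⟩
        ≡⟨ ≡.cong (λ q → coeff ((a , v) ∷ p) v * F v + ⟨ F ∣ q ⟩) (delete-∷ a v p) ⟩
      coeff ((a , v) ∷ p) v * F v + ⟨ F ∣ delete v p ⟩
        ≈⟨ +-cong (*-≈0 (hyp v)) (go n (delete v p) (ℕₚ.≤-trans (length-delete v p) len) hyp′) ⟩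
      0# + 0#
        ≈⟨ +-identityʳ 0# ⟩
      0# ∎
      where
      hyp′ : ∀ u → coeff (delete v p) u ≈ 0# ⊎ F u ≈ 0#
      hyp′ u with ≡-dec ℕ._≟_ v u
      ... | yes refl = inj₁ (coeff-delete-≡ v p)
      ... | no v≢u with hyp u
      ...   | inj₁ p≈0 =
        inj₁ (trans (coeff-delete-≢ v p u v≢u) (trans (sym (coeff-∷-≢ a v p u v≢u)) p≈0))
      ...   | inj₂ F≈0 = inj₂ F≈0

  ⟨⟩-concentrated : ∀ F p w → (∀ v → v ≢ w → coeff p v ≈ 0# ⊎ F v ≈ 0#) → ⟨ F ∣ p ⟩ ≈ coeff p w * F w
  ⟨⟩-concentrated F p w off-w =
    trans (⟨⟩-delete F w p) (trans (+-congˡ (⟨⟩-vanishes F (delete w p) hyp)) (+-identityʳ _))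
    where
    hyp : ∀ v → coeff (delete w p) v ≈ 0# ⊎ F v ≈ 0#
    hyp v with ≡-dec ℕ._≟_ w v
    ... | yes refl = inj₁ (coeff-delete-≡ w p)
    ... | no w≢v with off-w v (λ v≡w → w≢v (≡.sym v≡w))
    ...   | inj₁ p≈0 = inj₁ (trans (coeff-delete-≢ w p v w≢v) p≈0)
    ...   | inj₂ F≈0 = inj₂ F≈0

  Invertible : K → Set (c Level.⊔ ℓ)
  Invertible = RightInvertible 1# _*_

  1#-invertible : Invertible 1#
  1#-invertible = 1# , *-identityʳ 1#

  invertible-cong : ∀ {x y} → x ≈ y → Invertible y → Invertible x
  invertible-cong x≈y (y⁻¹ , yy⁻¹≈1) = y⁻¹ , trans (*-congʳ x≈y) yy⁻¹≈1

  invertible-* : ∀ {x y} → Invertible x → Invertible y → Invertible (x * y)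
  invertible-* {x} {y} (x⁻¹ , xx⁻¹≈1) (y⁻¹ , yy⁻¹≈1) = x⁻¹ * y⁻¹ , (begin
    x * y * (x⁻¹ * y⁻¹)     ≈⟨ *-interchange x y x⁻¹ y⁻¹ ⟩
    x * x⁻¹ * (y * y⁻¹)     ≈⟨ *-cong xx⁻¹≈1 yy⁻¹≈1 ⟩
    1# * 1#                 ≈⟨ *-identityˡ 1# ⟩
    1#                      ∎)

  invertible-cancel : ∀ {x y} → x * y ≈ 0# → Invertible y → x ≈ 0#
  invertible-cancel {x} {y} xy≈0 (y⁻¹ , yy⁻¹≈1) = begin
    x              ≈⟨ *-identityʳ x ⟨
    x * 1#         ≈⟨ *-congˡ yy⁻¹≈1 ⟨
    x * (y * y⁻¹)  ≈⟨ *-assoc x y y⁻¹ ⟨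
    x * y * y⁻¹    ≈⟨ *-congʳ xy≈0 ⟩
    0# * y⁻¹       ≈⟨ zeroˡ y⁻¹ ⟩
    0#             ∎

  ⟨⟩-triangular : (weight : Word → ℕ) (F : Word → Fn) →
                  (∀ w v → F w v ≈ 0# ⊎ v ≡ w ⊎ weight v < weight w) →
                  ∀ p → (∀ w → coeff p w ≈ 0# ⊎ Invertible (F w w)) → (∀ w → ⟨ F w ∣ p ⟩ ≈ 0#) →
                  p ≈P 0P
  ⟨⟩-triangular weight F triangular p diagonal ⟨F∣p⟩≈0 w = go (suc (weight w)) w ℕₚ.≤-refl
    where
    go : ∀ n w → weight w < n → coeff p w ≈ 0#
    go (suc n) w (s≤s w≤n) with diagonal w
    ... | inj₁ p≈0 = p≈0
    ... | inj₂ inv =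
      invertible-cancel (trans (sym (⟨⟩-concentrated (F w) p w off-diagonal)) (⟨F∣p⟩≈0 w)) inv
      where
      off-diagonal : ∀ v → v ≢ w → coeff p v ≈ 0# ⊎ F w v ≈ 0#
      off-diagonal v v≢w with triangular w v
      ... | inj₁ F≈0         = inj₂ F≈0
      ... | inj₂ (inj₁ v≡w)  = ⊥-elim (v≢w v≡w)
      ... | inj₂ (inj₂ v<w)  = inj₁ (go n v (ℕₚ.<-≤-trans v<w w≤n))

  module StaircaseTest (H : ℕ → Fn) (H-support : ∀ k u → ¬ Words.Ascending k u → H k u ≈ 0#) where
    open Words

    ⋆-product-++ : ∀ k v a b → length a ≡ suc k → ⋆-product H (k ∷ v) (a ++ b) ≈ H k a * ⋆-product H v b
    ⋆-product-++ k v a b len = ⋆-split (H k) (⋆-product H v) a b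
      (λ u₁ u₂ eq u₁≢a → inj₁ (H-support k u₁
        (λ (len₁ , _) → u₁≢a (prefix-unique u₁ u₂ a b eq (≡.trans len₁ (≡.sym len))))))

    -- Compare the first letters k′ of v and k of w: k′ > k would need an ascending block longer than
    -- the first step of the staircase, and k′ < k cuts that step after k′ + 1 letters.
    ⋆-product-staircase : ∀ v s w → ⋆-product H v (staircase s w) ≈ 0# ⊎ v ≡ w ⊎ sum v < sum w
    ⋆-product-staircase []       s []      = inj₂ (inj₁ refl)
    ⋆-product-staircase []       s (k ∷ w) with r , eq ← staircase-head s k w rewrite eq =
      inj₁ (single-≢ 1# [] (s ∷ r) (λ ()))
    ⋆-product-staircase (k ∷ v)  s []      = inj₁ (*-≈0 (inj₁ (H-support k [] λ { (() , _) })))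
    ⋆-product-staircase (k′ ∷ v) s (k ∷ w) with compare k′ k
    ... | equal _ with ⋆-product-staircase v 0 w
    ...   | inj₁ ≈0           =
      inj₁ (trans (⋆-product-++ k v (run s k) (staircase 0 w) (length-run s k)) (*-≈0 (inj₂ ≈0)))
    ...   | inj₂ (inj₁ refl)  = inj₂ (inj₁ refl)
    ...   | inj₂ (inj₂ v<w)   = inj₂ (inj₂ (ℕₚ.+-monoʳ-< k v<w))
    ⋆-product-staircase (k′ ∷ v) s (k ∷ w) | less _ d with ⋆-product-staircase v (suc k′ ℕ.+ s) (d ∷ w)
    ...   | inj₁ ≈0           = inj₁ (begin
      ⋆-product H (k′ ∷ v) (staircase s (suc (k′ ℕ.+ d) ∷ w))
        ≡⟨ ≡.cong (⋆-product H (k′ ∷ v)) (staircase-split s k′ d w) ⟩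
      ⋆-product H (k′ ∷ v) (run s k′ ++ staircase (suc k′ ℕ.+ s) (d ∷ w))
        ≈⟨ ⋆-product-++ k′ v (run s k′) _ (length-run s k′) ⟩
      H k′ (run s k′) * ⋆-product H v (staircase (suc k′ ℕ.+ s) (d ∷ w))
        ≈⟨ *-≈0 (inj₂ ≈0) ⟩
      0# ∎)
    ...   | inj₂ (inj₁ refl)  = inj₂ (inj₂ (split-weight-< k′ d ℕₚ.≤-refl))
    ...   | inj₂ (inj₂ v<dw)  = inj₂ (inj₂ (split-weight-< k′ d (ℕₚ.<⇒≤ v<dw)))
    ⋆-product-staircase (k′ ∷ v) s (k ∷ w) | greater _ d = inj₁ (⋆-vanishes _ _ _ split)
      where
      split : ∀ u₁ u₂ → u₁ ++ u₂ ≡ staircase s (k ∷ w) → H k′ u₁ ≈ 0# ⊎ ⋆-product H v u₂ ≈ 0#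
      split u₁ u₂ eq = inj₁ (H-support k′ u₁ λ (len , lnk) →
        ¬Linked-staircase-prefix s k w eq
          (≡.subst (suc k <_) (≡.sym len) (s≤s (s≤s (ℕₚ.m≤m+n k d)))) lnk)

    ⋆-product-diagonal : ∀ w → All (λ k → Invertible (H k (run 0 k))) w →
                         Invertible (⋆-product H w (staircase 0 w))
    ⋆-product-diagonal []      []           = invertible-cong (+-identityʳ 1#) 1#-invertible
    ⋆-product-diagonal (k ∷ w) (inv ∷ invs) =
      invertible-cong (⋆-product-++ k w (run 0 k) (staircase 0 w) (length-run 0 k))
                      (invertible-* inv (⋆-product-diagonal w invs))

module Generators {c ℓ : Level} (R : CommutativeRing c ℓ) where
  open CommutativeRing R renaming (refl to ≈-refl) hiding (zero)
  open FreeSeq R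
  open Coefficients R
  open Words
  open import Algebra.Properties.CommutativeSemigroup +-commutativeSemigroup using (interchange)
  open import Relation.Binary.Reasoning.Setoid setoid

  coeff-gen-zero-suc : ∀ m → coeff (gen 0 (suc m)) ≐ coeff (gen 0 m) ⊕ coeff (var m)
  coeff-gen-zero-suc m = coeff-++ (gen 0 m) (var m)

  coeff-gen-suc-suc : ∀ k m →
    coeff (gen (suc k) (suc m)) ≐ coeff (gen (suc k) m) ⊕ coeff (gen k m) ⋆ coeff (var m)
  coeff-gen-suc-suc k m u =
    trans (coeff-++ (gen (suc k) m) (gen k m *P var m) u) (+-congˡ (coeff-*P (gen k m) (var m) u))

  gen-support : ∀ k m u → ¬ (Ascending k u × All (_< m) u) → coeff (gen k m) u ≈ 0#
  gen-support zero    zero    u _    = ≈-refl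
  gen-support (suc k) zero    u _    = ≈-refl
  gen-support zero    (suc m) u ¬asc = trans (coeff-gen-zero-suc m u)
    (trans (+-cong (gen-support zero m u (¬asc ∘ below-suc))
                   (single-≢ 1# (m ∷ []) u λ { refl → ¬asc ((refl , [-]) , ℕₚ.n<1+n m ∷ []) }))
           (+-identityʳ 0#))
  gen-support (suc k) (suc m) u ¬asc = trans (coeff-gen-suc-suc k m u)
    (trans (+-cong (gen-support (suc k) m u (¬asc ∘ below-suc))
                   (⋆-var-vanishes _ m u λ { u₁ refl → gen-support k m u₁ (¬asc ∘ ascending-∷ʳ) }))
           (+-identityʳ 0#))

  gen-ascending-support : ∀ k m u → ¬ Ascending k u → coeff (gen k m) u ≈ 0#
  gen-ascending-support k m u ¬asc = gen-support k m u (¬asc ∘ proj₁)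

  gen-run-above : ∀ k s m → m ≤ k ℕ.+ s → coeff (gen k m) (run s k) ≈ 0#
  gen-run-above k s m m≤ = gen-support k m (run s k) (λ (_ , below) → ℕₚ.<⇒≱ (run-below s k below) m≤)

  gen-run : ∀ k s m → k ℕ.+ s < m → coeff (gen k m) (run s k) ≈ 1#
  gen-run zero s (suc m) (s≤s s≤m) with ℕₚ.m≤n⇒m<n∨m≡n s≤m
  ... | inj₁ s<m = trans (coeff-gen-zero-suc m (s ∷ []))
    (trans (+-cong (gen-run zero s m s<m)
                   (single-≢ 1# (m ∷ []) (s ∷ []) λ { refl → ℕₚ.<-irrefl refl s<m }))
           (+-identityʳ 1#))
  ... | inj₂ refl = trans (coeff-gen-zero-suc s (s ∷ []))
    (trans (+-cong (gen-run-above zero s s ℕₚ.≤-refl) (single-≡ 1# (s ∷ []))) (+-identityˡ 1#))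
  gen-run (suc k) s (suc m) (s≤s k+s<m) with ℕₚ.m≤n⇒m<n∨m≡n k+s<m
  ... | inj₁ lt = trans (coeff-gen-suc-suc k m (run s (suc k)))
    (trans (+-cong (gen-run (suc k) s m lt) (⋆-var-vanishes (coeff (gen k m)) m (run s (suc k)) λ u₁ eq →
                     ⊥-elim (ℕₚ.<-irrefl (∷ʳ-injectiveʳ (run s k) u₁ (≡.trans (≡.sym (run-∷ʳ s k)) eq)) lt)))
           (+-identityʳ 1#))
  ... | inj₂ refl = begin
    coeff (gen (suc k) (suc m)) (run s (suc k))
      ≈⟨ coeff-gen-suc-suc k m _ ⟩
    coeff (gen (suc k) m) (run s (suc k)) + (coeff (gen k m) ⋆ coeff (var m)) (run s (suc k))
      ≡⟨ ≡.cong (λ u → coeff (gen (suc k) m) (run s (suc k)) + (coeff (gen k m) ⋆ coeff (var m)) u)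
                (run-∷ʳ s k) ⟩
    coeff (gen (suc k) m) (run s (suc k)) + (coeff (gen k m) ⋆ coeff (var m)) (run s k ∷ʳ m)
      ≈⟨ +-cong (gen-run-above (suc k) s m ℕₚ.≤-refl) (⋆-var-∷ʳ _ m (run s k)) ⟩
    0# + coeff (gen k m) (run s k)
      ≈⟨ +-identityˡ _ ⟩
    coeff (gen k m) (run s k)
      ≈⟨ gen-run k s m ℕₚ.≤-refl ⟩
    1# ∎

  coeff-ρ-vanishes : ∀ a u → (∀ j → coeff (a j) u ≈ 0#) → ∀ m → coeff (ρ a m) u ≈ 0#
  coeff-ρ-vanishes a u a≈0 zero    = ≈-refl
  coeff-ρ-vanishes a u a≈0 (suc m) = trans (coeff-++ (ρ a m) (a m) u)
    (trans (+-cong (coeff-ρ-vanishes a u a≈0 m) (a≈0 m)) (+-identityʳ 0#))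

  ρgen-ascending-support : ∀ k m u → ¬ Ascending k u → coeff (ρ (gen k) m) u ≈ 0#
  ρgen-ascending-support k m u ¬asc = coeff-ρ-vanishes (gen k) u (λ j → gen-ascending-support k j u ¬asc) m

  ρgen-run : ∀ k s m → coeff (ρ (gen k) m) (run s k) ≈ natCast R (m ℕ.∸ suc (k ℕ.+ s))
  ρgen-run k s zero = ≈-refl
  ρgen-run k s (suc m) with k ℕ.+ s ℕₚ.<? m
  ... | yes k+s<m = begin
    coeff (ρ (gen k) m ++ gen k m) (run s k)
      ≈⟨ coeff-++ (ρ (gen k) m) (gen k m) (run s k) ⟩
    coeff (ρ (gen k) m) (run s k) + coeff (gen k m) (run s k)
      ≈⟨ +-cong (ρgen-run k s m) (gen-run k s m k+s<m) ⟩
    natCast R (m ℕ.∸ suc (k ℕ.+ s)) + 1#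
      ≈⟨ +-comm _ 1# ⟩
    natCast R (suc (m ℕ.∸ suc (k ℕ.+ s)))
      ≡⟨ ≡.cong (natCast R) (ℕₚ.+-∸-assoc 1 k+s<m) ⟨
    natCast R (m ℕ.∸ (k ℕ.+ s)) ∎
  ... | no k+s≮m = begin
    coeff (ρ (gen k) m ++ gen k m) (run s k)
      ≈⟨ coeff-++ (ρ (gen k) m) (gen k m) (run s k) ⟩
    coeff (ρ (gen k) m) (run s k) + coeff (gen k m) (run s k)
      ≈⟨ +-cong (ρgen-run k s m) (gen-run-above k s m m≤k+s) ⟩
    natCast R (m ℕ.∸ suc (k ℕ.+ s)) + 0#
      ≈⟨ +-identityʳ _ ⟩
    natCast R (m ℕ.∸ suc (k ℕ.+ s))
      ≡⟨ ≡.cong (natCast R) (ℕₚ.m≤n⇒m∸n≡0 (ℕₚ.m≤n⇒m≤1+n m≤k+s)) ⟩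
    natCast R 0
      ≡⟨ ≡.cong (natCast R) (ℕₚ.m≤n⇒m∸n≡0 m≤k+s) ⟨
    natCast R (m ℕ.∸ (k ℕ.+ s)) ∎
    where m≤k+s = ℕₚ.≮⇒≥ k+s≮m

  coeff-ρ-+A : ∀ a b m → coeff (ρ (a +A b) m) ≐ coeff (ρ a m) ⊕ coeff (ρ b m)
  coeff-ρ-+A a b zero    u = sym (+-identityʳ 0#)
  coeff-ρ-+A a b (suc m) u = begin
    coeff (ρ (a +A b) m ++ (a m ++ b m)) u
      ≈⟨ coeff-++ (ρ (a +A b) m) (a m ++ b m) u ⟩
    coeff (ρ (a +A b) m) u + coeff (a m ++ b m) u
      ≈⟨ +-cong (coeff-ρ-+A a b m u) (coeff-++ (a m) (b m) u) ⟩
    (coeff (ρ a m) u + coeff (ρ b m) u) + (coeff (a m) u + coeff (b m) u)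
      ≈⟨ interchange _ _ _ _ ⟩
    (coeff (ρ a m) u + coeff (a m) u) + (coeff (ρ b m) u + coeff (b m) u)
      ≈⟨ +-cong (coeff-++ (ρ a m) (a m) u) (coeff-++ (ρ b m) (b m) u) ⟨
    coeff (ρ a (suc m)) u + coeff (ρ b (suc m)) u ∎

  coeff-ρ-·A : ∀ x a m u → coeff (ρ (x ·A a) m) u ≈ x * coeff (ρ a m) u
  coeff-ρ-·A x a zero    u = sym (zeroʳ x)
  coeff-ρ-·A x a (suc m) u = begin
    coeff (ρ (x ·A a) m ++ x ·P a m) u
      ≈⟨ coeff-++ (ρ (x ·A a) m) (x ·P a m) u ⟩
    coeff (ρ (x ·A a) m) u + coeff (x ·P a m) u
      ≈⟨ +-cong (coeff-ρ-·A x a m u) (coeff-· x (a m) u) ⟩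
    x * coeff (ρ a m) u + x * coeff (a m) u
      ≈⟨ distribˡ x _ _ ⟨
    x * (coeff (ρ a m) u + coeff (a m) u)
      ≈⟨ *-congˡ (coeff-++ (ρ a m) (a m) u) ⟨
    x * coeff (ρ a (suc m)) u ∎

  coeff-∗ρ : ∀ a b m → coeff ((a ∗ρ b) m) ≐
             coeff (ρ a m) ⋆ coeff (b m) ⊕ coeff (a m) ⋆ coeff (ρ b m) ⊕ coeff (a m) ⋆ coeff (b m)
  coeff-∗ρ a b m u = trans (coeff-++ (ρ a m *P b m ++ a m *P ρ b m) (a m *P b m) u)
    (+-cong (trans (coeff-++ (ρ a m *P b m) (a m *P ρ b m) u)
                   (+-cong (coeff-*P (ρ a m) (b m) u) (coeff-*P (a m) (ρ b m) u)))
            (coeff-*P (a m) (b m) u))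

  -- Since ρ(c)ₘ₊₁ = ρ(c)ₘ + cₘ, the product ρ(a)ₘρ(b)ₘ increases by exactly (a ∗ρ b)ₘ from m to m + 1.
  coeff-ρ-∗ρ : ∀ a b m → coeff (ρ (a ∗ρ b) m) ≐ coeff (ρ a m) ⋆ coeff (ρ b m)
  coeff-ρ-∗ρ a b zero    u = sym (⋆-vanishes _ _ u (λ _ _ _ → inj₁ ≈-refl))
  coeff-ρ-∗ρ a b (suc m) u = begin
    coeff (ρ (a ∗ρ b) m ++ (a ∗ρ b) m) u
      ≈⟨ coeff-++ (ρ (a ∗ρ b) m) ((a ∗ρ b) m) u ⟩
    coeff (ρ (a ∗ρ b) m) u + coeff ((a ∗ρ b) m) u
      ≈⟨ +-cong (coeff-ρ-∗ρ a b m u) (coeff-∗ρ a b m u) ⟩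
    (A ⋆ B) u + ((A ⋆ β) u + (α ⋆ B) u + (α ⋆ β) u)
      ≈⟨ +-congˡ (+-assoc _ _ _) ⟩
    (A ⋆ B) u + ((A ⋆ β) u + ((α ⋆ B) u + (α ⋆ β) u))
      ≈⟨ +-assoc _ _ _ ⟨
    (A ⋆ B) u + (A ⋆ β) u + ((α ⋆ B) u + (α ⋆ β) u)
      ≈⟨ +-cong (⋆-distribˡ A B β u) (⋆-distribˡ α B β u) ⟨
    (A ⋆ (B ⊕ β)) u + (α ⋆ (B ⊕ β)) u
      ≈⟨ ⋆-distribʳ A α (B ⊕ β) u ⟨
    ((A ⊕ α) ⋆ (B ⊕ β)) u
      ≈⟨ ⋆-cong (λ v → sym (coeff-++ (ρ a m) (a m) v)) (λ v → sym (coeff-++ (ρ b m) (b m) v)) u ⟩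
    (coeff (ρ a (suc m)) ⋆ coeff (ρ b (suc m))) u ∎
    where
    A = coeff (ρ a m)
    B = coeff (ρ b m)
    α = coeff (a m)
    β = coeff (b m)

  coeff-evalWord : ∀ m v → coeff (evalWord v m) ≐ ⋆-product (λ k → coeff (gen k m)) v
  coeff-evalWord m []      u = ≈-refl
  coeff-evalWord m (k ∷ v) u =
    trans (coeff-*P (gen k m) (evalWord v m) u) (⋆-cong (λ _ → ≈-refl) (coeff-evalWord m v) u)

  coeff-eval : ∀ m p u → coeff (eval p m) u ≈ ⟨ (λ v → coeff (evalWord v m) u) ∣ p ⟩
  coeff-eval m []            u = ≈-refl
  coeff-eval m ((a , v) ∷ p) u = trans (coeff-++ (a ·P evalWord v m) (eval p m) u)
    (+-cong (coeff-· a (evalWord v m) u) (coeff-eval m p u))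

  coeff-ρ-evalWordρ : ∀ m k v →
    coeff (ρ (evalWordρ (k ∷ v)) m) ≐ ⋆-product (λ k → coeff (ρ (gen k) m)) (k ∷ v)
  coeff-ρ-evalWordρ m k []      u = sym (⋆-identityʳ _ u)
  coeff-ρ-evalWordρ m k (j ∷ v) u = trans (coeff-ρ-∗ρ (gen k) (evalWordρ (j ∷ v)) m u)
    (⋆-cong (λ _ → ≈-refl) (coeff-ρ-evalWordρ m j v) u)

  coeff-ρ-evalρ : ∀ m p u → coeff (ρ (evalρ p) m) u ≈ ⟨ (λ v → coeff (ρ (evalWordρ v) m) u) ∣ p ⟩
  coeff-ρ-evalρ m []            u = coeff-ρ-vanishes 0A u (λ _ → ≈-refl) m
  coeff-ρ-evalρ m ((a , v) ∷ p) u = trans (coeff-ρ-+A (a ·A evalWordρ v) (evalρ p) m u)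
    (+-cong (coeff-ρ-·A a (evalWordρ v) m u) (coeff-ρ-evalρ m p u))

module FreeGeneration {c ℓ : Level} (R : CommutativeRing c ℓ) where
  open CommutativeRing R renaming (refl to ≈-refl) hiding (zero)
  open FreeSeq R
  open Coefficients R
  open Generators R
  open Words

  m≤n⇒m+0≤n : ∀ {m n} → m ≤ n → m ℕ.+ 0 ≤ n
  m≤n⇒m+0≤n {m} = ℕₚ.≤-trans (ℕₚ.≤-reflexive (ℕₚ.+-identityʳ m))

  freelyGenerate : FreelyGenerate
  freelyGenerate p eval≈0 = ⟨⟩-triangular sum F triangular p (λ w → inj₂ (diagonal w)) annihilates
    where
    m : Word → ℕ
    m w = suc (sum w)

    H : Word → ℕ → Fn
    H w k = coeff (gen k (m w))

    H-support : ∀ w k u → ¬ Ascending k u → H w k u ≈ 0#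
    H-support w k = gen-ascending-support k (m w)

    module Test (w : Word) = StaircaseTest (H w) (H-support w)

    F : Word → Fn
    F w v = coeff (evalWord v (m w)) (staircase 0 w)

    triangular : ∀ w v → F w v ≈ 0# ⊎ v ≡ w ⊎ sum v < sum w
    triangular w v with Test.⋆-product-staircase w v 0 w
    ... | inj₁ ≈0  = inj₁ (trans (coeff-evalWord (m w) v _) ≈0)
    ... | inj₂ v⊑w = inj₂ v⊑w

    diagonal : ∀ w → Invertible (F w w)
    diagonal w = invertible-cong (coeff-evalWord (m w) w _)
                                 (Test.⋆-product-diagonal w w (All.map run-invertible (All-≤-sum w)))
      where
      run-invertible : ∀ {k} → k ≤ sum w → Invertible (H w k (run 0 k))
      run-invertible {k} k≤ = invertible-cong (gen-run k 0 (m w) (s≤s (m≤n⇒m+0≤n k≤))) 1#-invertible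

    annihilates : ∀ w → ⟨ F w ∣ p ⟩ ≈ 0#
    annihilates w = trans (sym (coeff-eval (m w) p _)) (eval≈0 (m w) _)

  natCast-invertible : IsField R → CharZero R → ∀ {n} → 0 < n → Invertible (natCast R n)
  natCast-invertible isField charZero {suc n} _ = IsField.inverse isField (natCast R (suc n)) (charZero n)

  freelyGenerateρ : IsField R → CharZero R → FreelyGenerateρ
  freelyGenerateρ isField charZero p p[]≈0 evalρ≈0 = ⟨⟩-triangular sum F triangular p diagonal annihilates
    where
    -- One more than for freelyGenerate, so that the diagonal entries m ∸ (k + 1) are positive.
    m : Word → ℕ
    m w = suc (suc (sum w))

    H : Word → ℕ → Fn
    H w k = coeff (ρ (gen k) (m w))

    H-support : ∀ w k u → ¬ Ascending k u → H w k u ≈ 0#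
    H-support w k = ρgen-ascending-support k (m w)

    module Test (w : Word) = StaircaseTest (H w) (H-support w)

    F : Word → Fn
    F w v = coeff (ρ (evalWordρ v) (m w)) (staircase 0 w)

    triangular : ∀ w v → F w v ≈ 0# ⊎ v ≡ w ⊎ sum v < sum w
    triangular w []      = inj₁ (coeff-ρ-vanishes 0A _ (λ _ → ≈-refl) (m w))
    triangular w (k ∷ v) with Test.⋆-product-staircase w (k ∷ v) 0 w
    ... | inj₁ ≈0  = inj₁ (trans (coeff-ρ-evalWordρ (m w) k v _) ≈0)
    ... | inj₂ v⊑w = inj₂ v⊑w

    diagonal : ∀ w → coeff p w ≈ 0# ⊎ Invertible (F w w)
    diagonal []          = inj₁ p[]≈0
    diagonal w@(k ∷ w′) = inj₂ (invertible-cong (coeff-ρ-evalWordρ (m w) k w′ _)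
                                  (Test.⋆-product-diagonal w w (All.map run-invertible (All-≤-sum w))))
      where
      run-invertible : ∀ {j} → j ≤ sum w → Invertible (H w j (run 0 j))
      run-invertible {j} j≤ = invertible-cong (ρgen-run j 0 (m w))
        (natCast-invertible isField charZero (ℕₚ.m<n⇒0<n∸m (s≤s (s≤s (m≤n⇒m+0≤n j≤)))))

    annihilates : ∀ w → ⟨ F w ∣ p ⟩ ≈ 0#
    annihilates w =
      trans (sym (coeff-ρ-evalρ (m w) p _)) (coeff-ρ-vanishes (evalρ p) _ (λ j → evalρ≈0 j _) (m w))

mainTheorem4 : ∀ {c ℓ} (K : CommutativeRing c ℓ) → IsField K → CharZero K →
    FreeSeq.FreelyGenerate K × FreeSeq.FreelyGenerateρ K
mainTheorem4 K isField charZero =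
  FreeGeneration.freelyGenerate K , FreeGeneration.freelyGenerateρ K isField charZero
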